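{- Let $k$ be a positive integer, let $K=2^{3k+5}$, let $C>0$, and let $G$ be a $K$-almost-regular graph on $n$ vertices with average degree $d(G)=Cn^{1/k}$. Then at most $\frac{2^{2k+10}}{\sqrt{C}}\hom(C_{2k},G)$ of the homomorphic $2k$-cycles in $G$ are degenerate.
   Context: A graph is $K$-almost-regular if its maximum degree is at most $K$ times its minimum degree. A homomorphic $2k$-cycle in $G$ is a sequence $(v_1,\dots,v_{2k})$ of vertices with $v_iv_{i+1}\in E(G)$ for $1\le i\le 2k-1$ and $v_{2k}v_1\in E(G)$; it is non-degenerate if the $v_i$ are pairwise distinct and degenerate otherwise. $\hom(C_{2k},G)$ is the number of homomorphic $2k$-cycles in $G$. The average degree is $d(G)=2|E(G)|/n$. -}

module Defs where

open import Data.Nat using (ℕ; zero; suc; _+_; _*_; _∸_; _^_; _≤_; _<_; _≡ᵇ_)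
open import Data.Bool using (Bool; true; false; _∧_; _∨_; not; if_then_else_)
open import Data.Fin using (Fin; toℕ) renaming (zero to fzero; suc to fsuc)
open import Data.Vec.Functional using (Vector; _∷_)
open import Relation.Binary.PropositionalEquality using (_≡_)

record Graph (n : ℕ) : Set where
  field
    adj    : Fin n → Fin n → Bool
    sym    : ∀ u v → adj u v ≡ adj v u
    irrefl : ∀ v → adj v v ≡ false
open Graph public

sumFin : ∀ {m} → (Fin m → ℕ) → ℕ
sumFin {zero}  f = 0
sumFin {suc m} f = f fzero + sumFin (λ i → f (fsuc i))

allB : ∀ {m} → (Fin m → Bool) → Bool
allB {zero}  P = true
allB {suc m} P = P fzero ∧ allB (λ i → P (fsuc i))

countB : ∀ {m} → (Fin m → Bool) → ℕ
countB P = sumFin (λ i → if P i then 1 else 0)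

countSeq : (n L : ℕ) → (Vector (Fin n) L → Bool) → ℕ
countSeq n zero    P = if P (λ ()) then 1 else 0
countSeq n (suc L) P = sumFin (λ v → countSeq n L (λ f → P (v ∷ f)))

deg : ∀ {n} → Graph n → Fin n → ℕ
deg G v = countB (λ w → adj G v w)

-- sum of degrees = 2 |E(G)| ; the average degree is d(G) = degSum G / n
degSum : ∀ {n} → Graph n → ℕ
degSum G = sumFin (deg G)

-- maximum degree ≤ K · minimum degree, i.e. deg u ≤ K · deg v for all u v
AlmostRegular : ∀ {n} → ℕ → Graph n → Set
AlmostRegular K G = ∀ u v → deg G u ≤ K * deg G v

-- (v_0,…,v_{L-1}) is a homomorphic L-cycle: v_i v_{i+1} ∈ E for i < L-1
-- and v_{L-1} v_0 ∈ E
isHomCycle : ∀ {n} → Graph n → (L : ℕ) → Vector (Fin n) L → Bool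
isHomCycle G L f =
  allB (λ i → allB (λ j →
    not ((toℕ j ≡ᵇ suc (toℕ i)) ∨ ((toℕ i ≡ᵇ L ∸ 1) ∧ (toℕ j ≡ᵇ 0)))
    ∨ adj G (f i) (f j)))

isInjSeq : ∀ {n L} → Vector (Fin n) L → Bool
isInjSeq f = allB (λ i → allB (λ j →
  (toℕ i ≡ᵇ toℕ j) ∨ not (toℕ (f i) ≡ᵇ toℕ (f j))))

homCycle : ∀ {n} → Graph n → ℕ → ℕ
homCycle {n} G L = countSeq n L (isHomCycle G L)

degenCycle : ∀ {n} → Graph n → ℕ → ℕ
degenCycle {n} G L = countSeq n L (λ f → isHomCycle G L f ∧ not (isInjSeq f))

{-# OPTIONS --safe #-}

-- Write W m u v for the number of walks of length m from u to v.  A degenerate homomorphic 2k-cycle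
-- repeats some vertex u at two positions, so it splits into two closed walks at u whose lengths
-- l, r ≥ 1 add up to 2k.  By Cauchy–Schwarz, j ↦ W (2j) u u is log-convex, which gives
-- W l u u · W r u u ≤ deg u · W (2k − 2) u u.  Summing over the (2k)² pairs of positions and using
-- n · deg u ≤ K · d (d = degSum G), we get n · degen ≤ (2k)² K · d · hom(C_{2k−2}).
-- Sums of log-convex sequences are log-convex, so hom(C_{2k−2})^{k−1} ≤ d · hom(C_{2k})^{k−2}, and
-- log-convexity of the numbers of all walks of length 2j gives d^{2k} ≤ n^{2k} · hom(C_{2k}).
-- When d^k ≥ 2^{(4k+20)k} n^{k+1} these combine, after raising to the power k − 1, into the claim;
-- otherwise the claim already follows from degen ≤ hom.
module Submission where

open import Defs hiding (sym)
open import Data.Bool using (Bool; true; false; if_then_else_; T; _∧_; _∨_; not)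
open import Data.Bool.Properties using (T-∧; T-∨)
open import Data.Empty using (⊥-elim)
open import Data.Fin using (Fin; toℕ; fromℕ; inject₁) renaming (zero to fzero; suc to fsuc)
open import Data.Fin.Properties using (toℕ-injective; toℕ-fromℕ; toℕ-inject₁; toℕ<n)
open import Data.Nat
  using (ℕ; zero; suc; NonZero; >-nonZero; _+_; _*_; _^_; _∸_; _≡ᵇ_; _<ᵇ_; _≤_; _<_; z≤n; _≤′_; ≤′-refl; ≤′-step)
open import Data.Nat.Properties
open import Data.Nat.Tactic.RingSolver using (solve-∀)
open import Algebra.Properties.CommutativeSemigroup *-commutativeSemigroup
  using (interchange; x∙yz≈y∙xz; x∙yz≈yx∙z; x∙yz≈xz∙y; x∙yz≈y∙zx; xy∙z≈y∙xz; xy∙z≈x∙zy)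
open import Algebra.Properties.CommutativeSemigroup +-commutativeSemigroup
  using () renaming (interchange to +-interchange)
open import Algebra.Properties.Semiring.Sum +-*-semiring
  using (sum; sum-syntax; sum-cong-≗; ∑-comm; *-distribˡ-sum; *-distribʳ-sum)
open import Data.Product using (_,_; _×_; proj₁; proj₂; ∃; ∃₂)
open import Data.Sum using (_⊎_; inj₁; inj₂)
open import Data.Unit using (tt)
open import Data.Vec.Functional using (Vector; _∷_; tail)
open import Function using (_∘_)
open import Function.Bundles using (_⇔_; mk⇔; module Equivalence)
open Equivalence using (to; from)
open import Relation.Binary.Definitions using (tri<; tri≈; tri>)
open import Relation.Binary.PropositionalEquality
open import Relation.Nullary using (¬_; contradiction; yes; no)

-- Finite sums and the Cauchy–Schwarz inequality

sumFin≡sum : ∀ {m} (f : Vector ℕ m) → sumFin f ≡ sum f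
sumFin≡sum {zero}  f = refl
sumFin≡sum {suc m} f = cong (f fzero +_) (sumFin≡sum (tail f))

sum-mono : ∀ {m} {f g : Vector ℕ m} → (∀ i → f i ≤ g i) → sum f ≤ sum g
sum-mono {zero}  f≤g = z≤n
sum-mono {suc m} f≤g = +-mono-≤ (f≤g fzero) (sum-mono (f≤g ∘ fsuc))

sum-const : ∀ m c → ∑[ i < m ] c ≡ m * c
sum-const zero    c = refl
sum-const (suc m) c = cong (c +_) (sum-const m c)

term≤sum : ∀ {m} (f : Vector ℕ m) i → f i ≤ sum f
term≤sum f fzero    = m≤m+n _ _
term≤sum f (fsuc i) = ≤-trans (term≤sum (tail f) i) (m≤n+m _ _)

ind : Bool → ℕ
ind b = if b then 1 else 0

-- Vertices are compared through toℕ and ≡ᵇ, as in isInjSeq.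
δ : ∀ {n} → Fin n → Fin n → ℕ
δ u v = ind (toℕ u ≡ᵇ toℕ v)

δ-sym : ∀ {n} (u v : Fin n) → δ u v ≡ δ v u
δ-sym fzero    fzero    = refl
δ-sym fzero    (fsuc v) = refl
δ-sym (fsuc u) fzero    = refl
δ-sym (fsuc u) (fsuc v) = δ-sym u v

sum-δˡ : ∀ {n} (u : Fin n) (h : Vector ℕ n) → ∑[ v < n ] (δ u v * h v) ≡ h u
sum-δˡ {suc n} fzero    h = trans (cong₂ _+_ (+-identityʳ (h fzero)) (trans (sum-const n 0) (*-zeroʳ n)))
                                  (+-identityʳ (h fzero))
sum-δˡ {suc n} (fsuc u) h = sum-δˡ u (tail h)

sum-δʳ : ∀ {n} (u : Fin n) (h : Vector ℕ n) → ∑[ v < n ] (h v * δ v u) ≡ h u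
sum-δʳ u h = trans (sum-cong-≗ (λ v → trans (*-comm (h v) (δ v u)) (cong (_* h v) (δ-sym v u))))
                   (sum-δˡ u h)

m*m≤n*n⇒m≤n : ∀ {m n} → m * m ≤ n * n → m ≤ n
m*m≤n*n⇒m≤n {m} {n} m²≤n² with ≤-<-connex m n
... | inj₁ m≤n = m≤n
... | inj₂ n<m = contradiction m²≤n² (<⇒≱ (*-mono-< n<m n<m))

4mn≤[m+n]²-ordered : ∀ {m n} → m ≤ n → 4 * (m * n) ≤ (m + n) * (m + n)
4mn≤[m+n]²-ordered {m} m≤n with m≤n⇒∃[o]m+o≡n m≤n
... | d , refl = ≤-trans (m≤m+n _ (d * d)) (≤-reflexive (square m d))
  where
  square : ∀ m d → 4 * (m * (m + d)) + d * d ≡ (m + (m + d)) * (m + (m + d))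
  square = solve-∀

4mn≤[m+n]² : ∀ m n → 4 * (m * n) ≤ (m + n) * (m + n)
4mn≤[m+n]² m n with ≤-total m n
... | inj₁ m≤n = 4mn≤[m+n]²-ordered m≤n
... | inj₂ n≤m = subst₂ _≤_ (cong (4 *_) (*-comm n m)) (cong (λ s → s * s) (+-comm n m))
                        (4mn≤[m+n]²-ordered n≤m)

am-gm : ∀ z x y → z * z ≤ x * y → 2 * z ≤ x + y
am-gm z x y z²≤xy = m*m≤n*n⇒m≤n (begin
  (2 * z) * (2 * z)  ≡⟨ double² z ⟩
  4 * (z * z)        ≤⟨ *-monoʳ-≤ 4 z²≤xy ⟩
  4 * (x * y)        ≤⟨ 4mn≤[m+n]² x y ⟩
  (x + y) * (x + y)  ∎)
  where
  open ≤-Reasoning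
  double² : ∀ z → (2 * z) * (2 * z) ≡ 4 * (z * z)
  double² = solve-∀

cauchy-schwarz : ∀ {m} (c a b : Vector ℕ m) → (∀ i → c i * c i ≤ a i * b i) →
                 sum c * sum c ≤ sum a * sum b
cauchy-schwarz {zero}  c a b c²≤ab = z≤n
cauchy-schwarz {suc m} c a b c²≤ab = begin
  (c₀ + C) * (c₀ + C)                        ≡⟨ expand c₀ C ⟩
  c₀ * c₀ + (2 * (c₀ * C) + C * C)           ≤⟨ +-mono-≤ (c²≤ab fzero) (+-mono-≤ cross tail-bound) ⟩
  a₀ * b₀ + ((a₀ * B + A * b₀) + A * B)      ≡⟨ collect a₀ A b₀ B ⟩
  (a₀ + A) * (b₀ + B)                        ∎
  where
  open ≤-Reasoning
  c₀ = c fzero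
  a₀ = a fzero
  b₀ = b fzero
  C = sum (tail c)
  A = sum (tail a)
  B = sum (tail b)
  tail-bound : C * C ≤ A * B
  tail-bound = cauchy-schwarz (tail c) (tail a) (tail b) (c²≤ab ∘ fsuc)
  cross : 2 * (c₀ * C) ≤ a₀ * B + A * b₀
  cross = am-gm (c₀ * C) (a₀ * B) (A * b₀) (begin
    (c₀ * C) * (c₀ * C)    ≡⟨ interchange c₀ C c₀ C ⟩
    (c₀ * c₀) * (C * C)    ≤⟨ *-mono-≤ (c²≤ab fzero) tail-bound ⟩
    (a₀ * b₀) * (A * B)    ≡⟨ regroup a₀ b₀ A B ⟩
    (a₀ * B) * (A * b₀)    ∎)
    where
    regroup : ∀ a b A B → (a * b) * (A * B) ≡ (a * B) * (A * b)
    regroup = solve-∀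
  expand : ∀ c C → (c + C) * (c + C) ≡ c * c + (2 * (c * C) + C * C)
  expand = solve-∀
  collect : ∀ a A b B → a * b + ((a * B + A * b) + A * B) ≡ (a + A) * (b + B)
  collect = solve-∀

^-distribʳ-* : ∀ m n o → (m * n) ^ o ≡ m ^ o * n ^ o
^-distribʳ-* m n zero    = refl
^-distribʳ-* m n (suc o) = trans (cong ((m * n) *_) (^-distribʳ-* m n o)) (interchange m n (m ^ o) (n ^ o))

m^n≤o^n⇒m≤o : ∀ {m o} n .{{_ : NonZero n}} → m ^ n ≤ o ^ n → m ≤ o
m^n≤o^n⇒m≤o {m} {o} n mⁿ≤oⁿ with ≤-<-connex m o
... | inj₁ m≤o = m≤o
... | inj₂ o<m = contradiction mⁿ≤oⁿ (<⇒≱ (^-monoˡ-< n o<m))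

*-cancelˡ-≤-unless-zero : ∀ x {a b} → x * a ≤ x * b → (x ≡ 0 → a ≤ b) → a ≤ b
*-cancelˡ-≤-unless-zero zero    xa≤xb x≡0⇒a≤b = x≡0⇒a≤b refl
*-cancelˡ-≤-unless-zero (suc x) xa≤xb x≡0⇒a≤b = *-cancelˡ-≤ (suc x) xa≤xb

^-swap : ∀ m a b → (m ^ a) ^ b ≡ (m ^ b) ^ a
^-swap m a b = trans (^-*-assoc m a b) (trans (cong (m ^_) (*-comm a b)) (sym (^-*-assoc m b a)))

-- Log-convex sequences

LogConvex : (ℕ → ℕ) → Set
LogConvex f = ∀ j → f (suc j) * f (suc j) ≤ f j * f (suc (suc j))

sum-logConvex : ∀ {m} (f : Fin m → ℕ → ℕ) → (∀ i → LogConvex (f i)) → LogConvex (λ j → ∑[ i < m ] f i j)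
sum-logConvex f convex j =
  cauchy-schwarz (λ i → f i (suc j)) (λ i → f i j) (λ i → f i (suc (suc j))) (λ i → convex i j)

module LogConvexSequence (f : ℕ → ℕ) (convex : LogConvex f) where

  ratio-mono : ∀ {a c} → a ≤′ c → f (suc a) * f c ≤ f a * f (suc c)
  ratio-mono {a} ≤′-refl = ≤-reflexive (*-comm (f (suc a)) (f a))
  ratio-mono {a} (≤′-step {c} a≤c) = *-cancelˡ-≤-unless-zero (f (suc c)) multiplied
    (λ f[1+c]≡0 → ≤-trans (≤-reflexive (trans (cong (f (suc a) *_) f[1+c]≡0) (*-zeroʳ (f (suc a))))) z≤n)
    where
    open ≤-Reasoning
    multiplied : f (suc c) * (f (suc a) * f (suc c)) ≤ f (suc c) * (f a * f (suc (suc c)))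
    multiplied = begin
      f (suc c) * (f (suc a) * f (suc c))   ≡⟨ x∙yz≈y∙xz (f (suc c)) (f (suc a)) (f (suc c)) ⟩
      f (suc a) * (f (suc c) * f (suc c))   ≤⟨ *-monoʳ-≤ (f (suc a)) (convex c) ⟩
      f (suc a) * (f c * f (suc (suc c)))   ≡⟨ *-assoc (f (suc a)) (f c) _ ⟨
      (f (suc a) * f c) * f (suc (suc c))   ≤⟨ *-monoˡ-≤ (f (suc (suc c))) (ratio-mono a≤c) ⟩
      (f a * f (suc c)) * f (suc (suc c))   ≡⟨ xy∙z≈y∙xz (f a) (f (suc c)) (f (suc (suc c))) ⟩
      f (suc c) * (f a * f (suc (suc c)))   ∎

  pair-bound-ordered : ∀ a b → a ≤ b → f (suc a) * f (suc b) ≤ f 1 * f (suc (a + b))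
  pair-bound-ordered zero    b a≤b = ≤-refl
  pair-bound-ordered (suc a) b a<b = begin
    f (suc (suc a)) * f (suc b)   ≤⟨ ratio-mono (≤⇒≤′ (m≤n⇒m≤1+n a<b)) ⟩
    f (suc a) * f (suc (suc b))   ≤⟨ pair-bound-ordered a (suc b) (m≤n⇒m≤1+n (<⇒≤ a<b)) ⟩
    f 1 * f (suc (a + suc b))     ≡⟨ cong (λ i → f 1 * f (suc i)) (+-suc a b) ⟩
    f 1 * f (suc (suc a + b))     ∎
    where open ≤-Reasoning

  pair-bound : ∀ a b → f (suc a) * f (suc b) ≤ f 1 * f (suc (a + b))
  pair-bound a b with ≤-total a b
  ... | inj₁ a≤b = pair-bound-ordered a b a≤b
  ... | inj₂ b≤a = subst₂ _≤_ (*-comm (f (suc b)) (f (suc a))) (cong (λ i → f 1 * f (suc i)) (+-comm b a))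
                          (pair-bound-ordered b a b≤a)

  power-upper : ∀ p → f (suc p) ^ suc p ≤ f 1 * f (suc (suc p)) ^ p
  power-upper zero    = ≤-refl
  power-upper (suc p) = *-cancelˡ-≤-unless-zero (x ^ p) multiplied
      (λ xᵖ≡0 → ≤-trans (≤-reflexive (cong (_^ suc (suc p)) (m^n≡0⇒m≡0 x p xᵖ≡0))) z≤n)
    where
    x = f (suc (suc p))
    y = f (suc p)
    z = f (suc (suc (suc p)))
    open ≤-Reasoning
    square-split : ∀ x X → X * (x * (x * X)) ≡ (x * x) * (X * X)
    square-split = solve-∀
    multiplied : x ^ p * x ^ suc (suc p) ≤ x ^ p * (f 1 * z ^ suc p)
    multiplied = begin
      x ^ p * x ^ suc (suc p)       ≡⟨ square-split x (x ^ p) ⟩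
      (x * x) * (x ^ p * x ^ p)     ≡⟨ cong ((x * x) *_) (^-distribʳ-* x x p) ⟨
      (x * x) ^ suc p               ≤⟨ ^-monoˡ-≤ (suc p) (convex (suc p)) ⟩
      (y * z) ^ suc p               ≡⟨ ^-distribʳ-* y z (suc p) ⟩
      y ^ suc p * z ^ suc p         ≤⟨ *-monoˡ-≤ (z ^ suc p) (power-upper p) ⟩
      (f 1 * x ^ p) * z ^ suc p     ≡⟨ xy∙z≈y∙xz (f 1) (x ^ p) (z ^ suc p) ⟩
      x ^ p * (f 1 * z ^ suc p)     ∎

  power-lower : ∀ p → f 1 ^ suc p ≤ f 0 ^ p * f (suc p)
  power-lower zero    = ≤-reflexive (trans (*-identityʳ (f 1)) (sym (*-identityˡ (f 1))))
  power-lower (suc p) = begin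
    f 1 * f 1 ^ suc p                  ≤⟨ *-monoʳ-≤ (f 1) (power-lower p) ⟩
    f 1 * (f 0 ^ p * f (suc p))        ≡⟨ x∙yz≈y∙xz (f 1) (f 0 ^ p) (f (suc p)) ⟩
    f 0 ^ p * (f 1 * f (suc p))        ≤⟨ *-monoʳ-≤ (f 0 ^ p) (ratio-mono (≤⇒≤′ z≤n)) ⟩
    f 0 ^ p * (f 0 * f (suc (suc p)))  ≡⟨ x∙yz≈yx∙z (f 0 ^ p) (f 0) (f (suc (suc p))) ⟩
    (f 0 * f 0 ^ p) * f (suc (suc p))  ∎
    where open ≤-Reasoning

-- Parity

data Parity : ℕ → Set where
  even : ∀ a → Parity (a + a)
  odd  : ∀ a → Parity (suc (a + a))

parity : ∀ m → Parity m
parity zero = even 0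
parity (suc m) with parity m
... | even a = odd a
... | odd a  = subst Parity (cong suc (+-suc a a)) (even (suc a))

m+m≡n+n⇒m≡n : ∀ {m n} → m + m ≡ n + n → m ≡ n
m+m≡n+n⇒m≡n {m} {n} eq =
  *-cancelˡ-≡ m n 2 (trans (cong (m +_) (+-identityʳ m)) (trans eq (cong (n +_) (sym (+-identityʳ n)))))

m+m≢1+n+n : ∀ m n → m + m ≢ suc (n + n)
m+m≢1+n+n zero    n       ()
m+m≢1+n+n (suc m) zero    eq = 0≢1+n (sym (trans (sym (+-suc m m)) (suc-injective eq)))
m+m≢1+n+n (suc m) (suc n) eq =
  m+m≢1+n+n m n (suc-injective (trans (sym (+-suc m m)) (trans (suc-injective eq) (cong suc (+-suc n n)))))

data EvenSum : ℕ → ℕ → ℕ → Set where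
  evens : ∀ a b → EvenSum (a + a) (b + b) (a + b)
  odds  : ∀ a b → EvenSum (suc (a + a)) (suc (b + b)) (suc (a + b))

evenSum-parity : ∀ {l r} k → Parity l → Parity r → l + r ≡ k + k → EvenSum l r k
evenSum-parity k (even a) (even b) a+a+b+b≡k+k =
  subst (EvenSum (a + a) (b + b)) (m+m≡n+n⇒m≡n (trans (+-interchange a b a b) a+a+b+b≡k+k)) (evens a b)
evenSum-parity k (odd a) (odd b) 1+a+a+1+b+b≡k+k =
  subst (EvenSum (suc (a + a)) (suc (b + b))) (m+m≡n+n⇒m≡n (trans shift 1+a+a+1+b+b≡k+k)) (odds a b)
  where
  shift : suc (a + b) + suc (a + b) ≡ suc (a + a) + suc (b + b)
  shift = cong suc (trans (+-suc (a + b) (a + b))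
                          (trans (cong suc (+-interchange a b a b)) (sym (+-suc (a + a) (b + b)))))
evenSum-parity k (even a) (odd b) a+a+1+b+b≡k+k =
  contradiction (trans (sym a+a+1+b+b≡k+k) (trans (+-suc (a + a) (b + b)) (cong suc (sym (+-interchange a b a b)))))
                (m+m≢1+n+n k (a + b))
evenSum-parity k (odd a) (even b) 1+a+a+b+b≡k+k =
  contradiction (trans (sym 1+a+a+b+b≡k+k) (cong suc (sym (+-interchange a b a b)))) (m+m≢1+n+n k (a + b))

evenSum : ∀ l r k → l + r ≡ k + k → EvenSum l r k
evenSum l r k = evenSum-parity k (parity l) (parity r)

cycle-lengths : ∀ {i j m} → i < j → j < m → suc (j ∸ suc i) + suc ((m ∸ suc j) + suc i) ≡ suc m
cycle-lengths {i} i<j j<m with m≤n⇒∃[o]m+o≡n i<j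
... | d , refl with m≤n⇒∃[o]m+o≡n j<m
...   | e , refl rewrite m+n∸m≡n (suc i) d | m+n∸m≡n (suc (suc i + d)) e = lengths i d e
  where
  lengths : ∀ i d e → suc d + suc (e + suc i) ≡ suc (suc (suc i + d) + e)
  lengths = solve-∀

-- Boolean indicators and sums over vertex sequences

ind-∧ : ∀ x y → ind (x ∧ y) ≡ ind x * ind y
ind-∧ true  y = sym (+-identityʳ (ind y))
ind-∧ false y = refl

T-ext : ∀ {x y} → (T x → T y) → (T y → T x) → x ≡ y
T-ext {true}  {true}  _   _   = refl
T-ext {true}  {false} x⇒y _   = ⊥-elim (x⇒y tt)
T-ext {false} {true}  _   y⇒x = ⊥-elim (y⇒x tt)
T-ext {false} {false} _   _   = refl

allB⇔ : ∀ {m} {P : Fin m → Bool} → T (allB P) ⇔ (∀ i → T (P i))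
allB⇔ {zero}      = mk⇔ (λ _ ()) (λ _ → tt)
allB⇔ {suc m} {P} = mk⇔
  (λ all → let head , rest = to T-∧ all in λ { fzero → head ; (fsuc i) → to allB⇔ rest i })
  (λ all → from T-∧ (all fzero , from allB⇔ (all ∘ fsuc)))

T-not-∨ : ∀ {c x} → T (not c ∨ x) ⇔ (T c → T x)
T-not-∨ {true}  = mk⇔ (λ x _ → x) (λ c⇒x → c⇒x tt)
T-not-∨ {false} = mk⇔ (λ _ ()) (λ _ → tt)

T⇒ind≡1 : ∀ {b} → T b → ind b ≡ 1
T⇒ind≡1 {true} _ = refl

¬T⇒ind≡0 : ∀ {b} → ¬ T b → ind b ≡ 0
¬T⇒ind≡0 {true}  ¬b = ⊥-elim (¬b tt)
¬T⇒ind≡0 {false} _  = refl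

ind≤ : ∀ b {c} → (T b → 1 ≤ c) → ind b ≤ c
ind≤ true  b⇒1≤c = b⇒1≤c tt
ind≤ false _     = z≤n

T-not⇒¬T : ∀ {b} → T (not b) → ¬ T b
T-not⇒¬T {false} _ ()

T-not-∨-not : ∀ x y → T (not (x ∨ not y)) → T (not x) × T y
T-not-∨-not false true _ = tt , tt

allB-witness : ∀ {m} (P : Fin m → Bool) → T (not (allB P)) → ∃ λ i → T (not (P i))
allB-witness {suc m} P ¬all with P fzero in P₀≡
... | false = fzero , subst (T ∘ not) (sym P₀≡) tt
... | true  = let i , ¬Pi = allB-witness (P ∘ fsuc) ¬all in fsuc i , ¬Pi

seqSum : ∀ {n} L → (Vector (Fin n) L → ℕ) → ℕ
seqSum         zero    w = w (λ ())
seqSum {n = n} (suc L) w = ∑[ v < n ] seqSum L (λ g → w (v ∷ g))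

countSeq≡seqSum : ∀ {n} L (P : Vector (Fin n) L → Bool) → countSeq n L P ≡ seqSum L (ind ∘ P)
countSeq≡seqSum zero    P = refl
countSeq≡seqSum {n} (suc L) P =
  trans (sumFin≡sum (λ v → countSeq n L (λ g → P (v ∷ g))))
        (sum-cong-≗ (λ v → countSeq≡seqSum L (λ g → P (v ∷ g))))

seqSum-cong : ∀ {n} L {w w′ : Vector (Fin n) L → ℕ} → (∀ g → w g ≡ w′ g) → seqSum L w ≡ seqSum L w′
seqSum-cong zero    w≗w′ = w≗w′ _
seqSum-cong (suc L) w≗w′ = sum-cong-≗ (λ v → seqSum-cong L (λ g → w≗w′ (v ∷ g)))

seqSum-mono : ∀ {n} L {w w′ : Vector (Fin n) L → ℕ} → (∀ g → w g ≤ w′ g) → seqSum L w ≤ seqSum L w′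
seqSum-mono zero    w≤w′ = w≤w′ _
seqSum-mono (suc L) w≤w′ = sum-mono (λ v → seqSum-mono L (λ g → w≤w′ (v ∷ g)))

seqSum-*ˡ : ∀ {n} L c (w : Vector (Fin n) L → ℕ) → seqSum L (λ g → c * w g) ≡ c * seqSum L w
seqSum-*ˡ         zero    c w = refl
seqSum-*ˡ {n = n} (suc L) c w =
  trans (sum-cong-≗ (λ v → seqSum-*ˡ L c (λ g → w (v ∷ g))))
        (sym (*-distribˡ-sum c (λ v → seqSum L (λ g → w (v ∷ g)))))

seqSum-∑ : ∀ {n m} L (w : Fin m → Vector (Fin n) L → ℕ) →
           seqSum L (λ g → ∑[ i < m ] w i g) ≡ ∑[ i < m ] seqSum L (w i)
seqSum-∑ zero    w = refl
seqSum-∑ (suc L) w = trans (sum-cong-≗ (λ v → seqSum-∑ L (λ i g → w i (v ∷ g))))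
                           (∑-comm (λ v i → seqSum L (λ g → w i (v ∷ g))))

ind-∧≤ : ∀ x y → ind (x ∧ y) ≤ ind x
ind-∧≤ true  y = ind≤ y (λ _ → ≤-refl)
ind-∧≤ false y = z≤n

coincidences : ∀ {n L} → Vector (Fin n) L → ℕ
coincidences {L = L} f = ∑[ i < L ] ∑[ j < L ] (ind (toℕ i <ᵇ toℕ j) * δ (f i) (f j))

coincidence : ∀ {n L} (f : Vector (Fin n) L) i j → toℕ i < toℕ j → δ (f i) (f j) ≡ 1 → 1 ≤ coincidences f
coincidence f i j i<j fi≡fj =
  ≤-trans (≤-reflexive (sym (cong₂ _*_ (T⇒ind≡1 (<⇒<ᵇ i<j)) fi≡fj)))
          (≤-trans (term≤sum (λ j → ind (toℕ i <ᵇ toℕ j) * δ (f i) (f j)) j)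
                   (term≤sum (λ i → ∑[ j < _ ] (ind (toℕ i <ᵇ toℕ j) * δ (f i) (f j))) i))

non-injective⇒coincidence : ∀ {n L} (f : Vector (Fin n) L) → T (not (isInjSeq f)) → 1 ≤ coincidences f
non-injective⇒coincidence f ¬inj with allB-witness _ ¬inj
... | i , ¬inj-i with allB-witness _ ¬inj-i
...   | j , ¬inj-ij with T-not-∨-not (toℕ i ≡ᵇ toℕ j) _ ¬inj-ij
...     | i≢j , fi≡fj with <-cmp (toℕ i) (toℕ j)
...       | tri< i<j _ _ = coincidence f i j i<j (T⇒ind≡1 fi≡fj)
...       | tri≈ _ i≡j _ = ⊥-elim (T-not⇒¬T i≢j (≡⇒≡ᵇ _ _ i≡j))
...       | tri> _ _ j<i = coincidence f j i j<i (trans (δ-sym (f j) (f i)) (T⇒ind≡1 fi≡fj))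

-- Walk counts

module Walks {n : ℕ} (G : Graph n) where

  A : Fin n → Fin n → ℕ
  A u v = ind (adj G u v)

  A-sym : ∀ u v → A u v ≡ A v u
  A-sym u v = cong ind (Graph.sym G u v)

  A-irrefl : ∀ u → A u u ≡ 0
  A-irrefl u = cong ind (irrefl G u)

  A-idem : ∀ u v → A u v * A u v ≡ A u v
  A-idem u v with adj G u v
  ... | true  = refl
  ... | false = refl

  W : ℕ → Fin n → Fin n → ℕ
  W zero    u v = δ u v
  W (suc m) u v = ∑[ x < n ] (A u x * W m x v)

  W-1 : ∀ u v → W 1 u v ≡ A u v
  W-1 u v = sum-δʳ v (A u)

  W-+ : ∀ a b u v → W (a + b) u v ≡ ∑[ x < n ] (W a u x * W b x v)
  W-+ zero    b u v = sym (sum-δˡ u (λ x → W b x v))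
  W-+ (suc a) b u v = begin
    ∑[ y < n ] (A u y * W (a + b) y v)
      ≡⟨ sum-cong-≗ (λ y → cong (A u y *_) (W-+ a b y v)) ⟩
    ∑[ y < n ] (A u y * ∑[ x < n ] (W a y x * W b x v))
      ≡⟨ sum-cong-≗ (λ y → *-distribˡ-sum (A u y) (λ x → W a y x * W b x v)) ⟩
    ∑[ y < n ] ∑[ x < n ] (A u y * (W a y x * W b x v))
      ≡⟨ ∑-comm (λ y x → A u y * (W a y x * W b x v)) ⟩
    ∑[ x < n ] ∑[ y < n ] (A u y * (W a y x * W b x v))
      ≡⟨ sum-cong-≗ {n} (λ x → sum-cong-≗ {n} (λ y → *-assoc (A u y) (W a y x) (W b x v))) ⟨
    ∑[ x < n ] ∑[ y < n ] (A u y * W a y x * W b x v)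
      ≡⟨ sum-cong-≗ {n} (λ x → *-distribʳ-sum (W b x v) (λ y → A u y * W a y x)) ⟨
    ∑[ x < n ] (W (suc a) u x * W b x v) ∎
    where open ≡-Reasoning

  W-sym : ∀ m u v → W m u v ≡ W m v u
  W-sym zero    u v = δ-sym u v
  W-sym (suc m) u v = begin
    ∑[ x < n ] (A u x * W m x v)
      ≡⟨ sum-cong-≗ (λ x → trans (cong₂ _*_ (A-sym u x) (W-sym m x v)) (*-comm (A x u) (W m v x))) ⟩
    ∑[ x < n ] (W m v x * A x u)
      ≡⟨ sum-cong-≗ (λ x → cong (W m v x *_) (W-1 x u)) ⟨
    ∑[ x < n ] (W m v x * W 1 x u)
      ≡⟨ W-+ m 1 v u ⟨
    W (m + 1) v u
      ≡⟨ cong (λ l → W l v u) (+-comm m 1) ⟩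
    W (suc m) v u ∎
    where open ≡-Reasoning

  W-1-diag : ∀ u → W 1 u u ≡ 0
  W-1-diag u = trans (W-1 u u) (A-irrefl u)

  W-2-diag : ∀ u → W 2 u u ≡ deg G u
  W-2-diag u = begin
    ∑[ x < n ] (A u x * W 1 x u)
      ≡⟨ sum-cong-≗ (λ x → trans (cong (A u x *_) (trans (W-1 x u) (A-sym x u))) (A-idem u x)) ⟩
    sum (A u)
      ≡⟨ sumFin≡sum (A u) ⟨
    deg G u ∎
    where open ≡-Reasoning

  W-cauchy-schwarz : ∀ a b u v → W (a + b) u v * W (a + b) u v ≤ W (a + a) u u * W (b + b) v v
  W-cauchy-schwarz a b u v = begin
    W (a + b) u v * W (a + b) u v
      ≡⟨ cong₂ _*_ (W-+ a b u v) (W-+ a b u v) ⟩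
    ∑[ x < n ] (W a u x * W b x v) * ∑[ x < n ] (W a u x * W b x v)
      ≤⟨ cauchy-schwarz _ (λ x → W a u x * W a x u) (λ x → W b v x * W b x v) termwise ⟩
    ∑[ x < n ] (W a u x * W a x u) * ∑[ x < n ] (W b v x * W b x v)
      ≡⟨ cong₂ _*_ (W-+ a a u u) (W-+ b b v v) ⟨
    W (a + a) u u * W (b + b) v v ∎
    where
    open ≤-Reasoning
    termwise : ∀ x → (W a u x * W b x v) * (W a u x * W b x v) ≤ (W a u x * W a x u) * (W b v x * W b x v)
    termwise x = ≤-reflexive (trans (interchange (W a u x) (W b x v) (W a u x) (W b x v))
                                    (cong₂ (λ s t → (W a u x * s) * (t * W b x v)) (W-sym a u x) (W-sym b x v)))

  closedWalks : Fin n → ℕ → ℕ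
  closedWalks u j = W (j + j) u u

  closedWalks-logConvex : ∀ u → LogConvex (closedWalks u)
  closedWalks-logConvex u j =
    subst (λ l → W l u u * W l u u ≤ closedWalks u j * closedWalks u (suc (suc j))) (+-suc j (suc j))
          (W-cauchy-schwarz j (suc (suc j)) u u)

  W-even : ∀ u a → W (suc (suc (a + a))) u u ≡ closedWalks u (suc a)
  W-even u a = cong (λ l → W (suc l) u u) (sym (+-suc a a))

  module _ (u : Fin n) where
    open LogConvexSequence (closedWalks u) (closedWalks-logConvex u)
    private
      ω = closedWalks u

    W-odd-cauchy-schwarz : ∀ a → W (suc (suc a + suc a)) u u * W (suc (suc a + suc a)) u u
                                 ≤ ω (suc a) * ω (suc (suc a))
    W-odd-cauchy-schwarz a =
      subst (λ l → W l u u * W l u u ≤ ω (suc a) * ω (suc (suc a))) (cong suc (+-suc a (suc a)))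
            (W-cauchy-schwarz (suc a) (suc (suc a)) u u)

    even-closedWalks-pair : ∀ a b → W (suc (suc (a + a))) u u * W (suc (suc (b + b))) u u
                                    ≤ W 2 u u * ω (suc (a + b))
    even-closedWalks-pair a b =
      subst₂ (λ x y → x * y ≤ W 2 u u * ω (suc (a + b))) (sym (W-even u a)) (sym (W-even u b)) (pair-bound a b)

    odd-closedWalks-pair : ∀ a b → W (suc (suc a + suc a)) u u * W (suc (suc b + suc b)) u u
                                   ≤ W 2 u u * ω (suc a + suc b)
    odd-closedWalks-pair a b = m*m≤n*n⇒m≤n (begin
      (X * Y) * (X * Y)
        ≡⟨ interchange X Y X Y ⟩
      (X * X) * (Y * Y)
        ≤⟨ *-mono-≤ (W-odd-cauchy-schwarz a) (W-odd-cauchy-schwarz b) ⟩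
      (ω (suc a) * ω (suc (suc a))) * (ω (suc b) * ω (suc (suc b)))
        ≡⟨ regroup (ω (suc a)) (ω (suc (suc a))) (ω (suc b)) (ω (suc (suc b))) ⟩
      (ω (suc a) * ω (suc (suc b))) * (ω (suc (suc a)) * ω (suc b))
        ≤⟨ *-mono-≤ (pair-bound a (suc b)) (pair-bound (suc a) b) ⟩
      (ω 1 * Z) * (ω 1 * ω (suc (suc a + b)))
        ≡⟨ cong (λ i → (ω 1 * Z) * (ω 1 * ω (suc i))) (+-suc a b) ⟨
      (ω 1 * Z) * (ω 1 * Z) ∎)
      where
      open ≤-Reasoning
      X = W (suc (suc a + suc a)) u u
      Y = W (suc (suc b + suc b)) u u
      Z = ω (suc a + suc b)
      regroup : ∀ p q r s → (p * q) * (r * s) ≡ (p * s) * (q * r)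
      regroup = solve-∀

    closedWalks-pair : ∀ l r k → l + r ≡ k + k → W (suc l) u u * W (suc r) u u ≤ W 2 u u * ω k
    closedWalks-pair l r k l+r≡k+k with evenSum l r k l+r≡k+k
    ... | odds a b = even-closedWalks-pair a b
    ... | evens zero b = ≤-trans (≤-reflexive (cong (_* W (suc (b + b)) u u) (W-1-diag u))) z≤n
    ... | evens (suc a) zero =
      ≤-trans (≤-reflexive (trans (cong (W (suc (suc a + suc a)) u u *_) (W-1-diag u))
                                  (*-zeroʳ (W (suc (suc a + suc a)) u u)))) z≤n
    ... | evens (suc a) (suc b) = odd-closedWalks-pair a b

  closedWalkCount : ℕ → ℕ
  closedWalkCount j = ∑[ u < n ] closedWalks u j

  closedWalkCount-logConvex : LogConvex closedWalkCount
  closedWalkCount-logConvex = sum-logConvex closedWalks closedWalks-logConvex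

  closedWalkCount-1 : closedWalkCount 1 ≡ degSum G
  closedWalkCount-1 = trans (sum-cong-≗ W-2-diag) (sym (sumFin≡sum (deg G)))

  walksFrom : ℕ → Fin n → ℕ
  walksFrom m u = ∑[ v < n ] W m u v

  walksFrom-1 : ∀ u → walksFrom 1 u ≡ deg G u
  walksFrom-1 u = trans (sum-cong-≗ (W-1 u)) (sym (sumFin≡sum (A u)))

  totalWalks : ℕ → ℕ
  totalWalks m = ∑[ u < n ] walksFrom m u

  totalWalks-+ : ∀ a b → totalWalks (a + b) ≡ ∑[ x < n ] (walksFrom a x * walksFrom b x)
  totalWalks-+ a b = begin
    ∑[ u < n ] ∑[ v < n ] W (a + b) u v
      ≡⟨ sum-cong-≗ (λ u → sum-cong-≗ (W-+ a b u)) ⟩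
    ∑[ u < n ] ∑[ v < n ] ∑[ x < n ] (W a u x * W b x v)
      ≡⟨ sum-cong-≗ (λ u → ∑-comm (λ v x → W a u x * W b x v)) ⟩
    ∑[ u < n ] ∑[ x < n ] ∑[ v < n ] (W a u x * W b x v)
      ≡⟨ sum-cong-≗ {n} (λ u → sum-cong-≗ {n} (λ x → *-distribˡ-sum (W a u x) (W b x))) ⟨
    ∑[ u < n ] ∑[ x < n ] (W a u x * walksFrom b x)
      ≡⟨ ∑-comm (λ u x → W a u x * walksFrom b x) ⟩
    ∑[ x < n ] ∑[ u < n ] (W a u x * walksFrom b x)
      ≡⟨ sum-cong-≗ {n} (λ x → *-distribʳ-sum (walksFrom b x) (λ u → W a u x)) ⟨
    ∑[ x < n ] (∑[ u < n ] W a u x * walksFrom b x)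
      ≡⟨ sum-cong-≗ (λ x → cong (_* walksFrom b x) (sum-cong-≗ (λ u → W-sym a u x))) ⟩
    ∑[ x < n ] (walksFrom a x * walksFrom b x) ∎
    where open ≡-Reasoning

  walkCount : ℕ → ℕ
  walkCount j = totalWalks (j + j)

  walkCount-logConvex : LogConvex walkCount
  walkCount-logConvex j = begin
    walkCount (suc j) * walkCount (suc j)
      ≡⟨ cong (λ l → totalWalks l * totalWalks l) (+-suc j (suc j)) ⟨
    totalWalks (j + suc (suc j)) * totalWalks (j + suc (suc j))
      ≡⟨ cong (λ s → s * s) (totalWalks-+ j (suc (suc j))) ⟩
    ∑[ x < n ] (α x * β x) * ∑[ x < n ] (α x * β x)
      ≤⟨ cauchy-schwarz _ (λ x → α x * α x) (λ x → β x * β x) (λ x → ≤-reflexive (interchange (α x) (β x) (α x) (β x))) ⟩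
    ∑[ x < n ] (α x * α x) * ∑[ x < n ] (β x * β x)
      ≡⟨ cong₂ _*_ (totalWalks-+ j j) (totalWalks-+ (suc (suc j)) (suc (suc j))) ⟨
    walkCount j * walkCount (suc (suc j)) ∎
    where
    open ≤-Reasoning
    α β : Fin n → ℕ
    α = walksFrom j
    β = walksFrom (suc (suc j))

  walkCount-0 : walkCount 0 ≡ n
  walkCount-0 = begin
    ∑[ u < n ] ∑[ v < n ] δ u v
      ≡⟨ sum-cong-≗ {n} (λ u → trans (sum-cong-≗ (λ v → sym (*-identityʳ (δ u v)))) (sum-δˡ u (λ _ → 1))) ⟩
    ∑[ u < n ] 1
      ≡⟨ trans (sum-const n 1) (*-identityʳ n) ⟩
    n ∎
    where open ≡-Reasoning

  degSum²≤n*walkCount-1 : degSum G * degSum G ≤ n * walkCount 1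
  degSum²≤n*walkCount-1 = begin
    degSum G * degSum G
      ≡⟨ cong (λ s → s * s) (sumFin≡sum (deg G)) ⟩
    sum (deg G) * sum (deg G)
      ≤⟨ cauchy-schwarz (deg G) (λ _ → 1) (λ x → deg G x * deg G x) (λ x → ≤-reflexive (sym (*-identityˡ _))) ⟩
    ∑[ x < n ] 1 * ∑[ x < n ] (deg G x * deg G x)
      ≡⟨ cong₂ _*_ (trans (sum-const n 1) (*-identityʳ n))
                   (sum-cong-≗ (λ x → sym (cong₂ _*_ (walksFrom-1 x) (walksFrom-1 x)))) ⟩
    n * ∑[ x < n ] (walksFrom 1 x * walksFrom 1 x)
      ≡⟨ cong (n *_) (totalWalks-+ 1 1) ⟨
    n * walkCount 1 ∎
    where open ≤-Reasoning

  walkCount≤n*closedWalkCount : ∀ k → walkCount k ≤ n * closedWalkCount k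
  walkCount≤n*closedWalkCount k = m*m≤n*n⇒m≤n (begin
    walkCount k * walkCount k
      ≤⟨ cauchy-schwarz (walksFrom (k + k)) (λ u → n * closedWalks u k) (λ _ → closedWalkCount k) row-bound ⟩
    ∑[ u < n ] (n * closedWalks u k) * ∑[ u < n ] closedWalkCount k
      ≡⟨ cong₂ _*_ (sym (*-distribˡ-sum n (λ u → closedWalks u k))) (sum-const n (closedWalkCount k)) ⟩
    (n * closedWalkCount k) * (n * closedWalkCount k) ∎)
    where
    open ≤-Reasoning
    row-bound : ∀ u → walksFrom (k + k) u * walksFrom (k + k) u ≤ (n * closedWalks u k) * closedWalkCount k
    row-bound u = ≤-trans (cauchy-schwarz (W (k + k) u) (λ _ → closedWalks u k) (λ v → closedWalks v k)
                                          (λ v → W-cauchy-schwarz k k u v))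
                          (≤-reflexive (cong (_* closedWalkCount k) (sum-const n (closedWalks u k))))

  closedWalkCount-lower : ∀ p → (degSum G * degSum G) ^ suc p ≤ n ^ (suc p + suc p) * closedWalkCount (suc p)
  closedWalkCount-lower p = begin
    (degSum G * degSum G) ^ suc p
      ≤⟨ ^-monoˡ-≤ (suc p) degSum²≤n*walkCount-1 ⟩
    (n * walkCount 1) ^ suc p
      ≡⟨ ^-distribʳ-* n (walkCount 1) (suc p) ⟩
    n ^ suc p * walkCount 1 ^ suc p
      ≤⟨ *-monoʳ-≤ (n ^ suc p) (power-lower p) ⟩
    n ^ suc p * (walkCount 0 ^ p * walkCount (suc p))
      ≡⟨ cong (λ e → n ^ suc p * (e ^ p * walkCount (suc p))) walkCount-0 ⟩
    n ^ suc p * (n ^ p * walkCount (suc p))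
      ≤⟨ *-monoʳ-≤ (n ^ suc p) (*-monoʳ-≤ (n ^ p) (walkCount≤n*closedWalkCount (suc p))) ⟩
    n ^ suc p * (n ^ p * (n * t))
      ≡⟨ cong (n ^ suc p *_) (x∙yz≈yx∙z (n ^ p) n t) ⟩
    n ^ suc p * (n ^ suc p * t)
      ≡⟨ *-assoc (n ^ suc p) (n ^ suc p) t ⟨
    n ^ suc p * n ^ suc p * t
      ≡⟨ cong (_* t) (^-distribˡ-+-* n (suc p) (suc p)) ⟨
    n ^ (suc p + suc p) * t ∎
    where
    open ≤-Reasoning
    open LogConvexSequence walkCount walkCount-logConvex using (power-lower)
    t = closedWalkCount (suc p)

  closedWalkCount-upper : ∀ p → closedWalkCount (suc p) ^ suc p ≤ degSum G * closedWalkCount (suc (suc p)) ^ p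
  closedWalkCount-upper p = subst (λ d → closedWalkCount (suc p) ^ suc p ≤ d * closedWalkCount (suc (suc p)) ^ p)
                                  closedWalkCount-1 (power-upper p)
    where open LogConvexSequence closedWalkCount closedWalkCount-logConvex using (power-upper)

  degreeWeightedClosedWalks : ℕ → ℕ
  degreeWeightedClosedWalks p = ∑[ u < n ] (W 2 u u * closedWalks u p)

  n*deg≤ : ∀ {K} → AlmostRegular K G → ∀ u → n * deg G u ≤ K * degSum G
  n*deg≤ {K} regular u = begin
    n * deg G u               ≡⟨ sum-const n (deg G u) ⟨
    ∑[ v < n ] deg G u        ≤⟨ sum-mono (regular u) ⟩
    ∑[ v < n ] (K * deg G v)  ≡⟨ *-distribˡ-sum K (deg G) ⟨
    K * sum (deg G)           ≡⟨ cong (K *_) (sumFin≡sum (deg G)) ⟨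
    K * degSum G              ∎
    where open ≤-Reasoning

  n*degreeWeightedClosedWalks≤ : ∀ {K} → AlmostRegular K G → ∀ p →
                                 n * degreeWeightedClosedWalks p ≤ K * (degSum G * closedWalkCount p)
  n*degreeWeightedClosedWalks≤ {K} regular p = begin
    n * ∑[ u < n ] (W 2 u u * closedWalks u p)
      ≡⟨ *-distribˡ-sum n (λ u → W 2 u u * closedWalks u p) ⟩
    ∑[ u < n ] (n * (W 2 u u * closedWalks u p))
      ≤⟨ sum-mono (λ u → ≤-trans (≤-reflexive (degree u)) (*-monoˡ-≤ (closedWalks u p) (n*deg≤ {K} regular u))) ⟩
    ∑[ u < n ] (K * degSum G * closedWalks u p)
      ≡⟨ *-distribˡ-sum (K * degSum G) (λ u → closedWalks u p) ⟨
    K * degSum G * closedWalkCount p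
      ≡⟨ *-assoc K (degSum G) (closedWalkCount p) ⟩
    K * (degSum G * closedWalkCount p) ∎
    where
    open ≤-Reasoning
    degree : ∀ u → n * (W 2 u u * closedWalks u p) ≡ n * deg G u * closedWalks u p
    degree u = trans (sym (*-assoc n (W 2 u u) (closedWalks u p)))
                     (cong (λ w → n * w * closedWalks u p) (W-2-diag u))

  degSum≤n² : degSum G ≤ n * n
  degSum≤n² = begin
    degSum G              ≡⟨ sumFin≡sum (deg G) ⟩
    sum (deg G)           ≤⟨ sum-mono deg≤n ⟩
    ∑[ u < n ] n          ≡⟨ sum-const n n ⟩
    n * n                 ∎
    where
    open ≤-Reasoning
    A≤1 : ∀ u v → A u v ≤ 1
    A≤1 u v with adj G u v
    ... | true  = ≤-refl
    ... | false = z≤n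
    deg≤n : ∀ u → deg G u ≤ n
    deg≤n u = begin
      deg G u       ≡⟨ sumFin≡sum (A u) ⟩
      sum (A u)     ≤⟨ sum-mono (A≤1 u) ⟩
      ∑[ v < n ] 1  ≡⟨ trans (sum-const n 1) (*-identityʳ n) ⟩
      n             ∎

-- Homomorphic cycles

module Cycles {n : ℕ} (G : Graph n) where

  open Walks G

  isWalk : ∀ {m} → Vector (Fin n) (suc m) → Fin n → Bool
  isWalk {zero}  f b = adj G (f fzero) b
  isWalk {suc m} f b = adj G (f fzero) (f (fsuc fzero)) ∧ isWalk (tail f) b

  Steps : ∀ {m} → Vector (Fin n) (suc m) → Set
  Steps {m} f = ∀ (i : Fin m) → T (adj G (f (inject₁ i)) (f (fsuc i)))

  isWalk⇔ : ∀ {m} (f : Vector (Fin n) (suc m)) b → T (isWalk f b) ⇔ (Steps f × T (adj G (f (fromℕ m)) b))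
  isWalk⇔ {zero}  f b = mk⇔ (λ last → (λ ()) , last) proj₂
  isWalk⇔ {suc m} f b = mk⇔
    (λ walk → let first , rest = to T-∧ walk ; steps , last = to (isWalk⇔ (tail f) b) rest
              in (λ { fzero → first ; (fsuc i) → steps i }) , last)
    (λ (steps , last) → from T-∧ (steps fzero , from (isWalk⇔ (tail f) b) (steps ∘ fsuc , last)))

  cyclicSucc : ∀ L → Fin L → Fin L → Bool
  cyclicSucc L i j = (toℕ j ≡ᵇ suc (toℕ i)) ∨ ((toℕ i ≡ᵇ L ∸ 1) ∧ (toℕ j ≡ᵇ 0))

  isHomCycle⇔ : ∀ {L} (f : Vector (Fin n) L) →
                T (isHomCycle G L f) ⇔ (∀ i j → T (cyclicSucc L i j) → T (adj G (f i) (f j)))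
  isHomCycle⇔ f = mk⇔ (λ cycle i j → to T-not-∨ (to allB⇔ (to allB⇔ cycle i) j))
                      (λ cycle → from allB⇔ (λ i → from allB⇔ (λ j → from T-not-∨ (cycle i j))))

  isHomCycle≡isWalk : ∀ {m} (f : Vector (Fin n) (suc m)) → isHomCycle G (suc m) f ≡ isWalk f (f fzero)
  isHomCycle≡isWalk {m} f = T-ext
    (λ cycle → from (isWalk⇔ f (f fzero))
       ( (λ i → to (isHomCycle⇔ f) cycle (inject₁ i) (fsuc i)
                   (from T-∨ (inj₁ (≡⇒≡ᵇ _ _ (cong suc (sym (toℕ-inject₁ i)))))))
       , to (isHomCycle⇔ f) cycle (fromℕ m) fzero
            (from T-∨ (inj₂ (from T-∧ (≡⇒≡ᵇ _ _ (toℕ-fromℕ m) , tt))))))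
    (λ walk → let steps , closing = to (isWalk⇔ f (f fzero)) walk
              in from (isHomCycle⇔ f) (λ i j succ → edge steps closing i j (to T-∨ succ)))
    where
    edge : Steps f → T (adj G (f (fromℕ m)) (f fzero)) → ∀ i j →
           T (toℕ j ≡ᵇ suc (toℕ i)) ⊎ T ((toℕ i ≡ᵇ m) ∧ (toℕ j ≡ᵇ 0)) → T (adj G (f i) (f j))
    edge steps closing i (fsuc j) (inj₁ j≡1+i) =
      subst (λ x → T (adj G (f x) (f (fsuc j))))
            (toℕ-injective (trans (toℕ-inject₁ j) (suc-injective (≡ᵇ⇒≡ _ _ j≡1+i)))) (steps j)
    edge steps closing i fzero (inj₂ last) =
      subst (λ x → T (adj G (f x) (f fzero)))
            (toℕ-injective (trans (toℕ-fromℕ m) (sym (≡ᵇ⇒≡ _ _ (proj₁ (to T-∧ last)))))) closing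
    edge steps closing i (fsuc j) (inj₂ last) = ⊥-elim (proj₂ (to T-∧ last))

  count-walks : ∀ m a b → seqSum m (λ g → ind (isWalk (a ∷ g) b)) ≡ W (suc m) a b
  count-walks zero    a b = sym (W-1 a b)
  count-walks (suc m) a b = sum-cong-≗ (λ v → begin
    seqSum m (λ g → ind (adj G a v ∧ isWalk (v ∷ g) b))   ≡⟨ seqSum-cong m (λ g → ind-∧ (adj G a v) _) ⟩
    seqSum m (λ g → A a v * ind (isWalk (v ∷ g) b))       ≡⟨ seqSum-*ˡ m (A a v) _ ⟩
    A a v * seqSum m (λ g → ind (isWalk (v ∷ g) b))       ≡⟨ cong (A a v *_) (count-walks m v b) ⟩
    A a v * W (suc m) v b                                 ∎)
    where open ≡-Reasoning

  count-walks-step : ∀ m a b (w : Vector (Fin n) (suc m) → ℕ) →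
    seqSum (suc m) (λ g → ind (isWalk (a ∷ g) b) * w g)
      ≡ ∑[ v < n ] (A a v * seqSum m (λ g → ind (isWalk (v ∷ g) b) * w (v ∷ g)))
  count-walks-step m a b w = sum-cong-≗ (λ v →
    trans (seqSum-cong m (λ g → trans (cong (_* w (v ∷ g)) (ind-∧ (adj G a v) _)) (*-assoc (A a v) _ _)))
          (seqSum-*ˡ m (A a v) _))

  W-suc-* : ∀ l a u c → ∑[ v < n ] (A a v * (W l v u * c)) ≡ W (suc l) a u * c
  W-suc-* l a u c = trans (sum-cong-≗ (λ v → sym (*-assoc (A a v) (W l v u) c)))
                          (sym (*-distribʳ-sum c (λ v → A a v * W l v u)))

  A-pin : ∀ a u (h : Fin n → ℕ) → ∑[ v < n ] (A a v * (δ v u * h v)) ≡ W 1 a u * h u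
  A-pin a u h = begin
    ∑[ v < n ] (A a v * (δ v u * h v))  ≡⟨ sum-cong-≗ (λ v → x∙yz≈xz∙y (A a v) (δ v u) (h v)) ⟩
    ∑[ v < n ] (A a v * h v * δ v u)    ≡⟨ sum-δʳ u (λ v → A a v * h v) ⟩
    A a u * h u                         ≡⟨ cong (_* h u) (W-1 a u) ⟨
    W 1 a u * h u                       ∎
    where open ≡-Reasoning

  count-walks-through : ∀ {m} (i : Fin m) a b u →
    seqSum m (λ g → ind (isWalk (a ∷ g) b) * δ (g i) u)
      ≡ W (suc (toℕ i)) a u * W (suc (m ∸ suc (toℕ i))) u b
  count-walks-through {suc m} fzero a b u = begin
    seqSum (suc m) (λ g → ind (isWalk (a ∷ g) b) * δ (g fzero) u)
      ≡⟨ count-walks-step m a b (λ g → δ (g fzero) u) ⟩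
    ∑[ v < n ] (A a v * seqSum m (λ g → ind (isWalk (v ∷ g) b) * δ v u))
      ≡⟨ sum-cong-≗ (λ v → cong (A a v *_) (pull-out v)) ⟩
    ∑[ v < n ] (A a v * (δ v u * W (suc m) v b))
      ≡⟨ A-pin a u (λ v → W (suc m) v b) ⟩
    W 1 a u * W (suc m) u b ∎
    where
    open ≡-Reasoning
    pull-out : ∀ v → seqSum m (λ g → ind (isWalk (v ∷ g) b) * δ v u) ≡ δ v u * W (suc m) v b
    pull-out v = begin
      seqSum m (λ g → ind (isWalk (v ∷ g) b) * δ v u)
        ≡⟨ seqSum-cong m (λ g → *-comm (ind (isWalk (v ∷ g) b)) (δ v u)) ⟩
      seqSum m (λ g → δ v u * ind (isWalk (v ∷ g) b))
        ≡⟨ seqSum-*ˡ m (δ v u) (λ g → ind (isWalk (v ∷ g) b)) ⟩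
      δ v u * seqSum m (λ g → ind (isWalk (v ∷ g) b))
        ≡⟨ cong (δ v u *_) (count-walks m v b) ⟩
      δ v u * W (suc m) v b ∎
  count-walks-through {suc m} (fsuc i) a b u = begin
    seqSum (suc m) (λ g → ind (isWalk (a ∷ g) b) * δ (g (fsuc i)) u)
      ≡⟨ count-walks-step m a b (λ g → δ (g (fsuc i)) u) ⟩
    ∑[ v < n ] (A a v * seqSum m (λ g → ind (isWalk (v ∷ g) b) * δ (g i) u))
      ≡⟨ sum-cong-≗ (λ v → cong (A a v *_) (count-walks-through i v b u)) ⟩
    ∑[ v < n ] (A a v * (W (suc (toℕ i)) v u * W (suc (m ∸ suc (toℕ i))) u b))
      ≡⟨ W-suc-* (suc (toℕ i)) a u _ ⟩
    W (suc (suc (toℕ i))) a u * W (suc (m ∸ suc (toℕ i))) u b ∎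
    where open ≡-Reasoning

  count-walks-through-twice : ∀ {m} (i j : Fin m) → toℕ i < toℕ j → ∀ a b u →
    seqSum m (λ g → ind (isWalk (a ∷ g) b) * (δ (g i) u * δ (g j) u))
      ≡ W (suc (toℕ i)) a u * (W (suc (toℕ j ∸ suc (toℕ i))) u u * W (suc (m ∸ suc (toℕ j))) u b)
  count-walks-through-twice {suc m} fzero (fsuc j) _ a b u = begin
    seqSum (suc m) (λ g → ind (isWalk (a ∷ g) b) * (δ (g fzero) u * δ (g (fsuc j)) u))
      ≡⟨ count-walks-step m a b (λ g → δ (g fzero) u * δ (g (fsuc j)) u) ⟩
    ∑[ v < n ] (A a v * seqSum m (λ g → ind (isWalk (v ∷ g) b) * (δ v u * δ (g j) u)))
      ≡⟨ sum-cong-≗ (λ v → cong (A a v *_) (pull-out v)) ⟩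
    ∑[ v < n ] (A a v * (δ v u * (W (suc (toℕ j)) v u * W (suc (m ∸ suc (toℕ j))) u b)))
      ≡⟨ A-pin a u (λ v → W (suc (toℕ j)) v u * W (suc (m ∸ suc (toℕ j))) u b) ⟩
    W 1 a u * (W (suc (toℕ j)) u u * W (suc (m ∸ suc (toℕ j))) u b) ∎
    where
    open ≡-Reasoning
    pull-out : ∀ v → seqSum m (λ g → ind (isWalk (v ∷ g) b) * (δ v u * δ (g j) u))
                     ≡ δ v u * (W (suc (toℕ j)) v u * W (suc (m ∸ suc (toℕ j))) u b)
    pull-out v = begin
      seqSum m (λ g → ind (isWalk (v ∷ g) b) * (δ v u * δ (g j) u))
        ≡⟨ seqSum-cong m (λ g → x∙yz≈y∙xz (ind (isWalk (v ∷ g) b)) (δ v u) (δ (g j) u)) ⟩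
      seqSum m (λ g → δ v u * (ind (isWalk (v ∷ g) b) * δ (g j) u))
        ≡⟨ seqSum-*ˡ m (δ v u) (λ g → ind (isWalk (v ∷ g) b) * δ (g j) u) ⟩
      δ v u * seqSum m (λ g → ind (isWalk (v ∷ g) b) * δ (g j) u)
        ≡⟨ cong (δ v u *_) (count-walks-through j v b u) ⟩
      δ v u * (W (suc (toℕ j)) v u * W (suc (m ∸ suc (toℕ j))) u b) ∎
  count-walks-through-twice {suc m} (fsuc i) (fsuc j) i<j a b u = begin
    seqSum (suc m) (λ g → ind (isWalk (a ∷ g) b) * (δ (g (fsuc i)) u * δ (g (fsuc j)) u))
      ≡⟨ count-walks-step m a b (λ g → δ (g (fsuc i)) u * δ (g (fsuc j)) u) ⟩
    ∑[ v < n ] (A a v * seqSum m (λ g → ind (isWalk (v ∷ g) b) * (δ (g i) u * δ (g j) u)))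
      ≡⟨ sum-cong-≗ (λ v → cong (A a v *_) (count-walks-through-twice i j (≤-pred i<j) v b u)) ⟩
    ∑[ v < n ] (A a v * (W (suc (toℕ i)) v u * R))
      ≡⟨ W-suc-* (suc (toℕ i)) a u R ⟩
    W (suc (suc (toℕ i))) a u * R ∎
    where
    open ≡-Reasoning
    R = W (suc (toℕ j ∸ suc (toℕ i))) u u * W (suc (m ∸ suc (toℕ j))) u b

  homCycle≡trace : ∀ m → homCycle G (suc m) ≡ ∑[ a < n ] W (suc m) a a
  homCycle≡trace m = begin
    homCycle G (suc m)
      ≡⟨ countSeq≡seqSum (suc m) (isHomCycle G (suc m)) ⟩
    ∑[ a < n ] seqSum m (λ g → ind (isHomCycle G (suc m) (a ∷ g)))
      ≡⟨ sum-cong-≗ (λ a → seqSum-cong m (λ g → cong ind (isHomCycle≡isWalk (a ∷ g)))) ⟩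
    ∑[ a < n ] seqSum m (λ g → ind (isWalk (a ∷ g) a))
      ≡⟨ sum-cong-≗ (λ a → count-walks m a a) ⟩
    ∑[ a < n ] W (suc m) a a ∎
    where open ≡-Reasoning

  homCycle≡closedWalkCount : ∀ k → homCycle G (2 * suc k) ≡ closedWalkCount (suc k)
  homCycle≡closedWalkCount k =
    trans (homCycle≡trace (k + suc (k + 0))) (cong (λ l → ∑[ a < n ] W (suc (k + suc l)) a a) (+-identityʳ k))

  revisiting-cycles : ∀ m (i j : Fin (suc m)) → toℕ i < toℕ j → ∃₂ λ l r → suc l + suc r ≡ suc m ×
    seqSum (suc m) (λ f → ind (isHomCycle G (suc m) f) * δ (f i) (f j))
      ≡ ∑[ u < n ] (W (suc l) u u * W (suc r) u u)
  revisiting-cycles m fzero (fsuc j) _ =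
    toℕ j , m ∸ suc (toℕ j) , cong suc (trans (+-suc (toℕ j) _) (m+[n∸m]≡n (toℕ<n j))) , (begin
    ∑[ a < n ] seqSum m (λ g → ind (isHomCycle G (suc m) (a ∷ g)) * δ a (g j))
      ≡⟨ sum-cong-≗ (λ a → seqSum-cong m (λ g →
           cong₂ _*_ (cong ind (isHomCycle≡isWalk (a ∷ g))) (δ-sym a (g j)))) ⟩
    ∑[ a < n ] seqSum m (λ g → ind (isWalk (a ∷ g) a) * δ (g j) a)
      ≡⟨ sum-cong-≗ (λ a → count-walks-through j a a a) ⟩
    ∑[ a < n ] (W (suc (toℕ j)) a a * W (suc (m ∸ suc (toℕ j))) a a) ∎)
    where open ≡-Reasoning
  revisiting-cycles m (fsuc i) (fsuc j) i<j =
    l , r , cycle-lengths (≤-pred i<j) (toℕ<n j) , (begin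
    ∑[ a < n ] seqSum m (λ g → ind (isHomCycle G (suc m) (a ∷ g)) * δ (g i) (g j))
      ≡⟨ sum-cong-≗ (λ a → seqSum-cong m (λ g →
           cong₂ _*_ (cong ind (isHomCycle≡isWalk (a ∷ g))) (δ-via (g i) (g j)))) ⟩
    ∑[ a < n ] seqSum m (λ g → ind (isWalk (a ∷ g) a) * ∑[ u < n ] (δ (g i) u * δ (g j) u))
      ≡⟨ sum-cong-≗ (λ a →
           trans (seqSum-cong m (λ g → *-distribˡ-sum (ind (isWalk (a ∷ g) a)) (λ u → δ (g i) u * δ (g j) u)))
                 (seqSum-∑ m (λ u g → ind (isWalk (a ∷ g) a) * (δ (g i) u * δ (g j) u)))) ⟩
    ∑[ a < n ] ∑[ u < n ] seqSum m (λ g → ind (isWalk (a ∷ g) a) * (δ (g i) u * δ (g j) u))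
      ≡⟨ sum-cong-≗ (λ a → sum-cong-≗ (λ u → count-walks-through-twice i j (≤-pred i<j) a a u)) ⟩
    ∑[ a < n ] ∑[ u < n ] (W (suc (toℕ i)) a u * (W (suc l) u u * W (suc (m ∸ suc (toℕ j))) u a))
      ≡⟨ ∑-comm (λ a u → W (suc (toℕ i)) a u * (W (suc l) u u * W (suc (m ∸ suc (toℕ j))) u a)) ⟩
    ∑[ u < n ] ∑[ a < n ] (W (suc (toℕ i)) a u * (W (suc l) u u * W (suc (m ∸ suc (toℕ j))) u a))
      ≡⟨ sum-cong-≗ (λ u →
           trans (sum-cong-≗ (λ a → x∙yz≈y∙zx (W (suc (toℕ i)) a u) (W (suc l) u u) _))
                 (sym (*-distribˡ-sum (W (suc l) u u) (λ a → W (suc (m ∸ suc (toℕ j))) u a * W (suc (toℕ i)) a u)))) ⟩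
    ∑[ u < n ] (W (suc l) u u * ∑[ a < n ] (W (suc (m ∸ suc (toℕ j))) u a * W (suc (toℕ i)) a u))
      ≡⟨ sum-cong-≗ (λ u → cong (W (suc l) u u *_) (W-+ (suc (m ∸ suc (toℕ j))) (suc (toℕ i)) u u)) ⟨
    ∑[ u < n ] (W (suc l) u u * W (suc r) u u) ∎)
    where
    open ≡-Reasoning
    l = toℕ j ∸ suc (toℕ i)
    r = (m ∸ suc (toℕ j)) + suc (toℕ i)
    δ-via : ∀ x y → δ x y ≡ ∑[ u < n ] (δ x u * δ y u)
    δ-via x y = sym (trans (sum-δˡ x (δ y)) (δ-sym y x))

  revisiting-cycles≤ : ∀ p (i j : Fin (2 * suc p)) →
    seqSum (2 * suc p) (λ f → ind (isHomCycle G (2 * suc p) f) * (ind (toℕ i <ᵇ toℕ j) * δ (f i) (f j)))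
      ≤ degreeWeightedClosedWalks p
  revisiting-cycles≤ p i j with toℕ i <? toℕ j
  ... | yes i<j with revisiting-cycles (p + suc (p + 0)) i j i<j
  ...   | l , r , lengths , pinned = begin
    seqSum L (λ f → ind (isHomCycle G L f) * (ind (toℕ i <ᵇ toℕ j) * δ (f i) (f j)))
      ≡⟨ seqSum-cong L (λ f → cong (ind (isHomCycle G L f) *_)
                                   (trans (cong (_* δ (f i) (f j)) (T⇒ind≡1 (<⇒<ᵇ i<j))) (+-identityʳ _))) ⟩
    seqSum L (λ f → ind (isHomCycle G L f) * δ (f i) (f j))
      ≡⟨ pinned ⟩
    ∑[ u < n ] (W (suc l) u u * W (suc r) u u)
      ≤⟨ sum-mono (λ u → closedWalks-pair u l r p l+r≡p+p) ⟩
    degreeWeightedClosedWalks p ∎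
    where
    open ≤-Reasoning
    L = 2 * suc p
    l+r≡p+p : l + r ≡ p + p
    l+r≡p+p = suc-injective (begin-equality
      suc (l + r)        ≡⟨ +-suc l r ⟨
      l + suc r          ≡⟨ suc-injective lengths ⟩
      p + suc (p + 0)    ≡⟨ +-suc p (p + 0) ⟩
      suc (p + (p + 0))  ≡⟨ cong (λ i → suc (p + i)) (+-identityʳ p) ⟩
      suc (p + p)        ∎)
  revisiting-cycles≤ p i j | no i≮j = ≤-trans (≤-reflexive vanish) z≤n
    where
    L = 2 * suc p
    vanish : seqSum L (λ f → ind (isHomCycle G L f) * (ind (toℕ i <ᵇ toℕ j) * δ (f i) (f j))) ≡ 0
    vanish = trans (seqSum-cong L (λ f → trans (cong (λ b → ind (isHomCycle G L f) * (b * δ (f i) (f j)))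
                                                     (¬T⇒ind≡0 (i≮j ∘ <ᵇ⇒< (toℕ i) (toℕ j))))
                                               (*-zeroʳ (ind (isHomCycle G L f)))))
                   (seqSum-*ˡ {n} L 0 (λ _ → 0))

  degenerate≤coincidences : ∀ L (f : Vector (Fin n) L) →
    ind (isHomCycle G L f ∧ not (isInjSeq f)) ≤ ind (isHomCycle G L f) * coincidences f
  degenerate≤coincidences L f with isHomCycle G L f
  ... | false = z≤n
  ... | true  = ≤-trans (ind≤ (not (isInjSeq f)) (non-injective⇒coincidence f))
                        (≤-reflexive (sym (+-identityʳ (coincidences f))))

  degenCycle≤ : ∀ p → let L = 2 * suc p in degenCycle G L ≤ L * (L * degreeWeightedClosedWalks p)
  degenCycle≤ p = begin
    degenCycle G L
      ≡⟨ countSeq≡seqSum L (λ f → isHomCycle G L f ∧ not (isInjSeq f)) ⟩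
    seqSum L (λ f → ind (isHomCycle G L f ∧ not (isInjSeq f)))
      ≤⟨ seqSum-mono L (degenerate≤coincidences L) ⟩
    seqSum L (λ f → ind (isHomCycle G L f) * coincidences f)
      ≡⟨ seqSum-cong L (λ f →
           trans (*-distribˡ-sum (ind (isHomCycle G L f)) (λ i → ∑[ j < L ] (ind (toℕ i <ᵇ toℕ j) * δ (f i) (f j))))
                 (sum-cong-≗ {L} (λ i → *-distribˡ-sum (ind (isHomCycle G L f)) (λ j → ind (toℕ i <ᵇ toℕ j) * δ (f i) (f j))))) ⟩
    seqSum L (λ f → ∑[ i < L ] ∑[ j < L ] pinned i j f)
      ≡⟨ trans (seqSum-∑ L (λ i f → ∑[ j < L ] pinned i j f)) (sum-cong-≗ (λ i → seqSum-∑ L (pinned i))) ⟩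
    ∑[ i < L ] ∑[ j < L ] seqSum L (pinned i j)
      ≤⟨ sum-mono (λ i → sum-mono (λ j → revisiting-cycles≤ p i j)) ⟩
    ∑[ i < L ] ∑[ j < L ] degreeWeightedClosedWalks p
      ≡⟨ trans (sum-cong-≗ {L} (λ i → sum-const L (degreeWeightedClosedWalks p)))
               (sum-const L (L * degreeWeightedClosedWalks p)) ⟩
    L * (L * degreeWeightedClosedWalks p) ∎
    where
    open ≤-Reasoning
    L = 2 * suc p
    pinned : Fin L → Fin L → Vector (Fin n) L → ℕ
    pinned i j f = ind (isHomCycle G L f) * (ind (toℕ i <ᵇ toℕ j) * δ (f i) (f j))

-- Assembling the bound

module DenseArithmetic (p : ℕ) where

  q k : ℕ
  q = suc p
  k = suc q

  without-s : ∀ {N x d h b c s} → N * x ≤ c * (d * s) → s ^ q ≤ d * h ^ p → c ^ q ≤ b →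
              (N * x) ^ q ≤ b * (d ^ k * h ^ p)
  without-s {N} {x} {d} {h} {b} {c} {s} Nx≤cds sᵠ≤dhᵖ cᵠ≤b = begin
    (N * x) ^ q              ≤⟨ ^-monoˡ-≤ q Nx≤cds ⟩
    (c * (d * s)) ^ q        ≡⟨ trans (^-distribʳ-* c (d * s) q) (cong (c ^ q *_) (^-distribʳ-* d s q)) ⟩
    c ^ q * (d ^ q * s ^ q)  ≤⟨ *-mono-≤ cᵠ≤b (*-monoʳ-≤ (d ^ q) sᵠ≤dhᵖ) ⟩
    b * (d ^ q * (d * h ^ p)) ≡⟨ cong (b *_) (x∙yz≈yx∙z (d ^ q) d (h ^ p)) ⟩
    b * (d ^ k * h ^ p)      ∎
    where open ≤-Reasoning

  -- In logarithms: (k + 1) times the last hypothesis plus 2k times the middle one, less (k + 1)² log N.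
  without-b : ∀ {N D h b} → 0 < N → D * D ≤ N ^ (2 * k) * h → b * N ^ (k + 1) ≤ D →
              b ^ (k + 1) * D ^ (2 * k + q) ≤ h ^ (2 * k) * N ^ ((3 * k + 1) * q)
  without-b {N} {D} {h} {b} N>0 D²≤N²ᵏh bNᵏ⁺¹≤D =
    *-cancelˡ-≤ (N ^ e²) {{m^n≢0 N e² {{>-nonZero N>0}}}} (begin
      N ^ e² * (b ^ e * D ^ (2 * k + q))
        ≡⟨ xy∙z≈y∙xz (b ^ e) (N ^ e²) (D ^ (2 * k + q)) ⟨
      b ^ e * N ^ e² * D ^ (2 * k + q)
        ≡⟨ cong (λ z → b ^ e * z * D ^ (2 * k + q)) (^-*-assoc N e e) ⟨
      b ^ e * (N ^ e) ^ e * D ^ (2 * k + q)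
        ≡⟨ cong (_* D ^ (2 * k + q)) (^-distribʳ-* b (N ^ e) e) ⟨
      (b * N ^ e) ^ e * D ^ (2 * k + q)
        ≤⟨ *-monoˡ-≤ (D ^ (2 * k + q)) (^-monoˡ-≤ e bNᵏ⁺¹≤D) ⟩
      D ^ e * D ^ (2 * k + q)
        ≡⟨ ^-distribˡ-+-* D e (2 * k + q) ⟨
      D ^ (e + (2 * k + q))
        ≡⟨ cong (D ^_) (exponent-D p) ⟩
      D ^ (2 * k + 2 * k)
        ≡⟨ ^-distribˡ-+-* D (2 * k) (2 * k) ⟩
      D ^ (2 * k) * D ^ (2 * k)
        ≡⟨ ^-distribʳ-* D D (2 * k) ⟨
      (D * D) ^ (2 * k)
        ≤⟨ ^-monoˡ-≤ (2 * k) D²≤N²ᵏh ⟩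
      (N ^ (2 * k) * h) ^ (2 * k)
        ≡⟨ trans (^-distribʳ-* (N ^ (2 * k)) h (2 * k)) (cong (_* h ^ (2 * k)) (^-*-assoc N (2 * k) (2 * k))) ⟩
      N ^ (2 * k * (2 * k)) * h ^ (2 * k)
        ≡⟨ cong (λ z → N ^ z * h ^ (2 * k)) (exponent-N p) ⟩
      N ^ (e² + (3 * k + 1) * q) * h ^ (2 * k)
        ≡⟨ cong (_* h ^ (2 * k)) (^-distribˡ-+-* N e² ((3 * k + 1) * q)) ⟩
      N ^ e² * N ^ ((3 * k + 1) * q) * h ^ (2 * k)
        ≡⟨ xy∙z≈x∙zy (N ^ e²) (N ^ ((3 * k + 1) * q)) (h ^ (2 * k)) ⟩
      N ^ e² * (h ^ (2 * k) * N ^ ((3 * k + 1) * q)) ∎)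
    where
    open ≤-Reasoning
    e = k + 1
    e² = e * e
    exponent-D : ∀ p → (suc (suc p) + 1) + (2 * suc (suc p) + suc p) ≡ 2 * suc (suc p) + 2 * suc (suc p)
    exponent-D = solve-∀
    exponent-N : ∀ p → 2 * suc (suc p) * (2 * suc (suc p))
                       ≡ (suc (suc p) + 1) * (suc (suc p) + 1) + (3 * suc (suc p) + 1) * suc p
    exponent-N = solve-∀

  -- In logarithms, q times the goal is 2k times without-s plus without-b; so the q-th powers of both sides
  -- are compared after multiplying them by N ^ (2kq).
  bound : ∀ {N x d h b c s} → 0 < N → N * x ≤ c * (d * s) → s ^ q ≤ d * h ^ p →
          (d * d) ^ k ≤ N ^ (2 * k) * h → b * N ^ (k + 1) ≤ d ^ k → c ^ q ≤ b →
          x ^ (2 * k) * d ^ k ≤ b * h ^ (2 * k) * N ^ (k + 1)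
  bound {N} {x} {d} {h} {b} {c} {s} N>0 Nx≤cds sᵠ≤dhᵖ d²ᵏ≤N²ᵏh bNᵏ⁺¹≤dᵏ cᵠ≤b =
    m^n≤o^n⇒m≤o q (*-cancelˡ-≤ (N ^ E) {{m^n≢0 N E {{>-nonZero N>0}}}} powers)
    where
    D = d ^ k
    E = 2 * k * q

    D²≤N²ᵏh : D * D ≤ N ^ (2 * k) * h
    D²≤N²ᵏh = ≤-trans (≤-reflexive (sym (^-distribʳ-* d d k))) d²ᵏ≤N²ᵏh

    split-lhs : N ^ E * (x ^ (2 * k) * D) ^ q ≡ ((N * x) ^ q) ^ (2 * k) * D ^ q
    split-lhs = begin
      N ^ E * (x ^ (2 * k) * D) ^ q
        ≡⟨ cong (N ^ E *_) (trans (^-distribʳ-* (x ^ (2 * k)) D q) (cong (_* D ^ q) (^-*-assoc x (2 * k) q))) ⟩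
      N ^ E * (x ^ E * D ^ q)
        ≡⟨ *-assoc (N ^ E) (x ^ E) (D ^ q) ⟨
      N ^ E * x ^ E * D ^ q
        ≡⟨ cong (_* D ^ q) (trans (^-swap (N * x) q (2 * k)) (trans (^-*-assoc (N * x) (2 * k) q) (^-distribʳ-* N x E))) ⟨
      ((N * x) ^ q) ^ (2 * k) * D ^ q ∎
      where
      open ≡-Reasoning

    split-b : (b * (D * h ^ p)) ^ (2 * k) * D ^ q ≡ b ^ q * h ^ (2 * k * p) * (b ^ (k + 1) * D ^ (2 * k + q))
    split-b = begin
      (b * (D * h ^ p)) ^ (2 * k) * D ^ q
        ≡⟨ cong (_* D ^ q) (trans (^-distribʳ-* b (D * h ^ p) (2 * k))
                                  (cong (b ^ (2 * k) *_) (^-distribʳ-* D (h ^ p) (2 * k)))) ⟩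
      b ^ (2 * k) * (D ^ (2 * k) * (h ^ p) ^ (2 * k)) * D ^ q
        ≡⟨ cong₂ (λ β η → β * (D ^ (2 * k) * η) * D ^ q)
                 (trans (cong (b ^_) (exponent p)) (^-distribˡ-+-* b q (k + 1)))
                 (trans (^-swap h p (2 * k)) (^-*-assoc h (2 * k) p)) ⟩
      b ^ q * b ^ (k + 1) * (D ^ (2 * k) * h ^ (2 * k * p)) * D ^ q
        ≡⟨ regroup (b ^ q) (b ^ (k + 1)) (D ^ (2 * k)) (h ^ (2 * k * p)) (D ^ q) ⟩
      b ^ q * h ^ (2 * k * p) * (b ^ (k + 1) * (D ^ (2 * k) * D ^ q))
        ≡⟨ cong (λ z → b ^ q * h ^ (2 * k * p) * (b ^ (k + 1) * z)) (^-distribˡ-+-* D (2 * k) q) ⟨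
      b ^ q * h ^ (2 * k * p) * (b ^ (k + 1) * D ^ (2 * k + q)) ∎
      where
      open ≡-Reasoning
      exponent : ∀ p → 2 * suc (suc p) ≡ suc p + (suc (suc p) + 1)
      exponent = solve-∀
      regroup : ∀ b₁ b₂ D₁ η D₂ → b₁ * b₂ * (D₁ * η) * D₂ ≡ b₁ * η * (b₂ * (D₁ * D₂))
      regroup = solve-∀

    merge-rhs : b ^ q * h ^ (2 * k * p) * (h ^ (2 * k) * N ^ ((3 * k + 1) * q)) ≡ N ^ E * (b * h ^ (2 * k) * N ^ (k + 1)) ^ q
    merge-rhs = begin
      b ^ q * h ^ (2 * k * p) * (h ^ (2 * k) * N ^ ((3 * k + 1) * q))
        ≡⟨ cong (λ ν → b ^ q * h ^ (2 * k * p) * (h ^ (2 * k) * ν))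
                (trans (cong (N ^_) (exponent-N p)) (^-distribˡ-+-* N E ((k + 1) * q))) ⟩
      b ^ q * h ^ (2 * k * p) * (h ^ (2 * k) * (N ^ E * N ^ ((k + 1) * q)))
        ≡⟨ regroup (b ^ q) (h ^ (2 * k * p)) (h ^ (2 * k)) (N ^ E) (N ^ ((k + 1) * q)) ⟩
      N ^ E * (b ^ q * (h ^ (2 * k * p) * h ^ (2 * k)) * N ^ ((k + 1) * q))
        ≡⟨ cong (λ η → N ^ E * (b ^ q * η * N ^ ((k + 1) * q)))
                (trans (sym (^-distribˡ-+-* h (2 * k * p) (2 * k))) (cong (h ^_) (exponent-h p))) ⟩
      N ^ E * (b ^ q * h ^ (2 * k * q) * N ^ ((k + 1) * q))
        ≡⟨ cong (N ^ E *_) (cong₂ (λ η ν → b ^ q * η * ν) (^-*-assoc h (2 * k) q) (^-*-assoc N (k + 1) q)) ⟨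
      N ^ E * (b ^ q * (h ^ (2 * k)) ^ q * (N ^ (k + 1)) ^ q)
        ≡⟨ cong (N ^ E *_) (trans (^-distribʳ-* (b * h ^ (2 * k)) (N ^ (k + 1)) q)
                                  (cong (_* (N ^ (k + 1)) ^ q) (^-distribʳ-* b (h ^ (2 * k)) q))) ⟨
      N ^ E * (b * h ^ (2 * k) * N ^ (k + 1)) ^ q ∎
      where
      open ≡-Reasoning
      exponent-N : ∀ p → (3 * suc (suc p) + 1) * suc p ≡ 2 * suc (suc p) * suc p + (suc (suc p) + 1) * suc p
      exponent-N = solve-∀
      exponent-h : ∀ p → 2 * suc (suc p) * p + 2 * suc (suc p) ≡ 2 * suc (suc p) * suc p
      exponent-h = solve-∀
      regroup : ∀ β η₁ η₂ ν₁ ν₂ → β * η₁ * (η₂ * (ν₁ * ν₂)) ≡ ν₁ * (β * (η₁ * η₂) * ν₂)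
      regroup = solve-∀

    powers : N ^ E * (x ^ (2 * k) * D) ^ q ≤ N ^ E * (b * h ^ (2 * k) * N ^ (k + 1)) ^ q
    powers = begin
      N ^ E * (x ^ (2 * k) * D) ^ q
        ≡⟨ split-lhs ⟩
      ((N * x) ^ q) ^ (2 * k) * D ^ q
        ≤⟨ *-monoˡ-≤ (D ^ q) (^-monoˡ-≤ (2 * k) (without-s {N} {x} {d} {h} {b} {c} {s} Nx≤cds sᵠ≤dhᵖ cᵠ≤b)) ⟩
      (b * (D * h ^ p)) ^ (2 * k) * D ^ q
        ≡⟨ split-b ⟩
      b ^ q * h ^ (2 * k * p) * (b ^ (k + 1) * D ^ (2 * k + q))
        ≤⟨ *-monoʳ-≤ (b ^ q * h ^ (2 * k * p)) (without-b {N} {D} {h} {b} N>0 D²≤N²ᵏh bNᵏ⁺¹≤dᵏ) ⟩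
      b ^ q * h ^ (2 * k * p) * (h ^ (2 * k) * N ^ ((3 * k + 1) * q))
        ≡⟨ merge-rhs ⟩
      N ^ E * (b * h ^ (2 * k) * N ^ (k + 1)) ^ q ∎
      where
      open ≤-Reasoning

[k+3]²≤2^[k+4] : ∀ k → (k + 3) * (k + 3) ≤ 2 ^ (k + 4)
[k+3]²≤2^[k+4] zero    = m≤m+n 9 7
[k+3]²≤2^[k+4] (suc k) = begin
  (suc k + 3) * (suc k + 3)                              ≤⟨ m≤m+n _ (k * k + 4 * k + 2) ⟩
  (suc k + 3) * (suc k + 3) + (k * k + 4 * k + 2)        ≡⟨ doubling k ⟩
  2 * ((k + 3) * (k + 3))                                ≤⟨ *-monoʳ-≤ 2 ([k+3]²≤2^[k+4] k) ⟩
  2 * 2 ^ (k + 4)                                        ∎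
  where
  open ≤-Reasoning
  doubling : ∀ k → (suc k + 3) * (suc k + 3) + (k * k + 4 * k + 2) ≡ 2 * ((k + 3) * (k + 3))
  doubling = solve-∀

constant-bound : ∀ k → 2 * k * (2 * k) * 2 ^ (3 * k + 5) ≤ 2 ^ (4 * k + 20)
constant-bound k = begin
  2 * k * (2 * k) * 2 ^ (3 * k + 5)         ≡⟨ cong (_* 2 ^ (3 * k + 5)) (quadruple k) ⟩
  2 ^ 2 * (k * k) * 2 ^ (3 * k + 5)         ≤⟨ *-monoˡ-≤ (2 ^ (3 * k + 5)) (*-monoʳ-≤ (2 ^ 2) k²≤2^[k+4]) ⟩
  2 ^ 2 * 2 ^ (k + 4) * 2 ^ (3 * k + 5)     ≡⟨ cong (_* 2 ^ (3 * k + 5)) (^-distribˡ-+-* 2 2 (k + 4)) ⟨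
  2 ^ (2 + (k + 4)) * 2 ^ (3 * k + 5)       ≡⟨ ^-distribˡ-+-* 2 (2 + (k + 4)) (3 * k + 5) ⟨
  2 ^ (2 + (k + 4) + (3 * k + 5))           ≡⟨ cong (2 ^_) (exponent k) ⟩
  2 ^ (4 * k + 11)                          ≤⟨ ^-monoʳ-≤ 2 (+-monoʳ-≤ (4 * k) (m≤m+n 11 9)) ⟩
  2 ^ (4 * k + 20)                          ∎
  where
  open ≤-Reasoning
  k²≤2^[k+4] : k * k ≤ 2 ^ (k + 4)
  k²≤2^[k+4] = ≤-trans (*-mono-≤ (m≤m+n k 3) (m≤m+n k 3)) ([k+3]²≤2^[k+4] k)
  quadruple : ∀ k → 2 * k * (2 * k) ≡ 4 * (k * k)
  quadruple = solve-∀
  exponent : ∀ k → 2 + (k + 4) + (3 * k + 5) ≡ 4 * k + 11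
  exponent = solve-∀

constant-power-bound : ∀ q → let k = suc q in (2 * k * (2 * k) * 2 ^ (3 * k + 5)) ^ q ≤ 2 ^ ((4 * k + 20) * k)
constant-power-bound q = begin
  (2 * k * (2 * k) * 2 ^ (3 * k + 5)) ^ q  ≤⟨ ^-monoˡ-≤ q (constant-bound k) ⟩
  (2 ^ (4 * k + 20)) ^ q                   ≡⟨ ^-*-assoc 2 (4 * k + 20) q ⟩
  2 ^ ((4 * k + 20) * q)                   ≤⟨ ^-monoʳ-≤ 2 (*-monoʳ-≤ (4 * k + 20) (n≤1+n q)) ⟩
  2 ^ ((4 * k + 20) * k)                   ∎
  where
  open ≤-Reasoning
  k = suc q

degenCycle≤homCycle : ∀ {n} (G : Graph n) L → degenCycle G L ≤ homCycle G L
degenCycle≤homCycle G L = begin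
  degenCycle G L                                               ≡⟨ countSeq≡seqSum L _ ⟩
  seqSum L (λ f → ind (isHomCycle G L f ∧ not (isInjSeq f)))   ≤⟨ seqSum-mono L (λ f → ind-∧≤ (isHomCycle G L f) _) ⟩
  seqSum L (ind ∘ isHomCycle G L)                              ≡⟨ countSeq≡seqSum L _ ⟨
  homCycle G L                                                 ∎
  where open ≤-Reasoning

sparse-case : ∀ {n} (G : Graph n) k B → degSum G ^ k ≤ B * n ^ (k + 1) →
  degenCycle G (2 * k) ^ (2 * k) * degSum G ^ k ≤ B * homCycle G (2 * k) ^ (2 * k) * n ^ (k + 1)
sparse-case {n} G k B sparse = begin
  degenCycle G (2 * k) ^ (2 * k) * degSum G ^ k
    ≤⟨ *-mono-≤ (^-monoˡ-≤ (2 * k) (degenCycle≤homCycle G (2 * k))) sparse ⟩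
  homCycle G (2 * k) ^ (2 * k) * (B * n ^ (k + 1))
    ≡⟨ x∙yz≈yx∙z (homCycle G (2 * k) ^ (2 * k)) B (n ^ (k + 1)) ⟩
  B * homCycle G (2 * k) ^ (2 * k) * n ^ (k + 1) ∎
  where open ≤-Reasoning

dense-case : ∀ p {n} → 0 < n → (G : Graph n) → let k = suc (suc p) in
  AlmostRegular (2 ^ (3 * k + 5)) G → 2 ^ ((4 * k + 20) * k) * n ^ (k + 1) ≤ degSum G ^ k →
  degenCycle G (2 * k) ^ (2 * k) * degSum G ^ k ≤ 2 ^ ((4 * k + 20) * k) * homCycle G (2 * k) ^ (2 * k) * n ^ (k + 1)
dense-case p {n} n>0 G regular dense =
  DenseArithmetic.bound p {n} {degenCycle G L} {D} {homCycle G L} {2 ^ ((4 * k + 20) * k)} {L * L * K} {S}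
    n>0 n*X≤cDS (subst (λ h → S ^ suc p ≤ D * h ^ p) H≡ (closedWalkCount-upper p))
    (subst (λ h → (D * D) ^ k ≤ n ^ (2 * k) * h) H≡ D²ᵏ≤n²ᵏH) dense (constant-power-bound (suc p))
  where
  open Walks G
  open Cycles G
  k = suc (suc p)
  L = 2 * k
  K = 2 ^ (3 * k + 5)
  D = degSum G
  S = closedWalkCount (suc p)
  H≡ : closedWalkCount k ≡ homCycle G (2 * k)
  H≡ = sym (homCycle≡closedWalkCount (suc p))
  D²ᵏ≤n²ᵏH : (D * D) ^ k ≤ n ^ (2 * k) * closedWalkCount k
  D²ᵏ≤n²ᵏH = subst (λ e → (D * D) ^ k ≤ n ^ (k + e) * closedWalkCount k) (sym (+-identityʳ k))
                   (closedWalkCount-lower (suc p))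
  n*X≤cDS : n * degenCycle G L ≤ L * L * K * (D * S)
  n*X≤cDS = begin
    n * degenCycle G L
      ≤⟨ *-monoʳ-≤ n (degenCycle≤ (suc p)) ⟩
    n * (L * (L * degreeWeightedClosedWalks (suc p)))
      ≡⟨ trans (x∙yz≈y∙xz n L (L * Y)) (cong (L *_) (x∙yz≈y∙xz n L Y)) ⟩
    L * (L * (n * degreeWeightedClosedWalks (suc p)))
      ≤⟨ *-monoʳ-≤ L (*-monoʳ-≤ L (n*degreeWeightedClosedWalks≤ {K} regular (suc p))) ⟩
    L * (L * (K * (D * S)))
      ≡⟨ trans (sym (*-assoc L L (K * (D * S)))) (sym (*-assoc (L * L) K (D * S))) ⟩
    L * L * K * (D * S) ∎
    where
    open ≤-Reasoning
    Y = degreeWeightedClosedWalks (suc p)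

-- The dense case needs k ≥ 2, and for k = 1 the graph is never dense because degSum G ≤ n².
lemma4p3 : (k : ℕ) → 0 < k → (n : ℕ) → 0 < n → (G : Graph n) →
    AlmostRegular (2 ^ (3 * k + 5)) G → 0 < degSum G →
    degenCycle G (2 * k) ^ (2 * k) * degSum G ^ k
    ≤ 2 ^ ((4 * k + 20) * k) * homCycle G (2 * k) ^ (2 * k) * n ^ (k + 1)
lemma4p3 (suc zero) _ n _ G _ _ = sparse-case G 1 (2 ^ ((4 * 1 + 20) * 1)) (begin
  degSum G * 1                           ≡⟨ *-identityʳ (degSum G) ⟩
  degSum G                               ≤⟨ Walks.degSum≤n² G ⟩
  n * n                                  ≡⟨ cong (n *_) (*-identityʳ n) ⟨
  n ^ 2                                  ≤⟨ m≤n*m (n ^ 2) (2 ^ ((4 * 1 + 20) * 1)) ⟩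
  2 ^ ((4 * 1 + 20) * 1) * n ^ (1 + 1)   ∎)
  where open ≤-Reasoning
lemma4p3 k@(suc (suc p)) _ n n>0 G regular _ with 2 ^ ((4 * k + 20) * k) * n ^ (k + 1) ≤? degSum G ^ k
... | yes dense  = dense-case p n>0 G regular dense
... | no  sparse = sparse-case G k (2 ^ ((4 * k + 20) * k)) (<⇒≤ (≰⇒> sparse))
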